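{- Let $n,p$ be integers with $p\ge 2$ and $n \geq p+2$, and let $T_1,T_2$ be two tournaments with vertex set $[n]$. There exists a family $X_1, \dots, X_\ell \subseteq [n]$ of subsets each of size exactly $p$ such that $T_2 = \mathrm{Inv}(T_1; X_1, \dots, X_\ell)$ if and only if one of the following occurs: (1) $p \equiv 0 \pmod 4$ and $|F(T_1)| \equiv |F(T_2)| \pmod 2$; (2) $p \equiv 1 \pmod 4$, $|F(T_1,i)| \equiv |F(T_2,i)| \pmod 2$ for every $i \in [n-1]$, and $|F(T_1)| \equiv |F(T_2)| \pmod 2$; (3) $p \equiv 2 \pmod 4$; (4) $p \equiv 3 \pmod 4$ and $|F(T_1,i)| \equiv |F(T_2,i)| \pmod 2$ for every $i \in [n-1]$.
   Context: For an oriented graph $D$ and $X\subseteq V(D)$, the inversion of $X$ reverses the orientation of every arc with both endpoints in $X$; $\mathrm{Inv}(D;X_1,\dots,X_\ell)$ denotes the oriented graph obtained by inverting $X_1,\dots,X_\ell$ one after another (equivalently, reversing exactly the arcs whose two endpoints lie together in an odd number of the $X_j$). For a tournament $T$ on $[n]$, an arc $ij$ is forward if $i<j$; $F(T)$ is the set of forward arcs of $T$, and $F(T,i)$ is the set of forward arcs of $T$ incident with vertex $i$. -}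

module Defs where

open import Data.Nat using (ℕ; _<_; _<ᵇ_)
open import Data.Bool using (Bool; true; false; not; _∧_; if_then_else_)
open import Data.Fin using (Fin; toℕ)
open import Data.Fin.Subset using (Subset; _∈_)
open import Data.Fin.Subset.Properties using (_∈?_)
open import Data.List using (List; map; allFin; foldl)
open import Data.Nat.ListAction using (sum)
open import Relation.Binary.PropositionalEquality using (_≡_; _≢_)
open import Relation.Nullary.Decidable using (⌊_⌋)

-- A tournament on vertex set Fin n (vertex k of Fin n is vertex k+1 of [n]).
-- adj i j ≡ true means the arc is oriented i → j.
record Tournament (n : ℕ) : Set where
  field
    adj    : Fin n → Fin n → Bool
    irrefl : ∀ i → adj i i ≡ false
    tourn  : ∀ i j → i ≢ j → adj i j ≡ not (adj j i)
open Tournament public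

mem : ∀ {n} → Fin n → Subset n → Bool
mem i X = ⌊ i ∈? X ⌋

invAdj : ∀ {n} → (Fin n → Fin n → Bool) → Subset n → Fin n → Fin n → Bool
invAdj a X i j = if mem i X ∧ mem j X then a j i else a i j

invAll : ∀ {n} → (Fin n → Fin n → Bool) → List (Subset n) → Fin n → Fin n → Bool
invAll = foldl invAdj

b2n : Bool → ℕ
b2n true  = 1
b2n false = 0

fwd : ∀ {n} → Tournament n → Fin n → Fin n → Bool
fwd T i j = (toℕ i <ᵇ toℕ j) ∧ adj T i j

numF : ∀ {n} → Tournament n → ℕ
numF {n} T = sum (map (λ i → sum (map (λ j → b2n (fwd T i j)) (allFin n))) (allFin n))

numFv : ∀ {n} → Tournament n → Fin n → ℕ
numFv {n} T i = sum (map (λ j → b2n (fwd T i j) Data.Nat.+ b2n (fwd T j i)) (allFin n))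

-- Work over GF(2) (Bool with xor). For i ≠ j the arc ij is reversed exactly when i and j lie together
-- in an odd number of the Xₖ, so T₂ = Inv(T₁; X₁, …, X_ℓ) iff the graph D of arcs on which T₁ and T₂
-- differ is the sum of the cliques on the Xₖ. A p-clique has even degrees when p is odd and an even
-- number of edges when C(p,2) is even; these are the necessary conditions, which become the stated ones
-- via the forward arcs and the residue of p mod 4. Conversely, for n ≥ p + 2 every 4-cycle is a sum
-- of four p-cliques, every graph with even degrees and an even number of edges is a sum of 4-cycles,
-- and one p-clique, or pairs of p-cliques sharing p − 1 vertices, correct the parity of the number of
-- edges and of the degrees whenever the conditions allow it.

module Submission where

open import Defs
open import Algebra using (CommutativeRing)
open import Data.Bool using (Bool; true; false; not; _∧_; _∨_; _xor_)
open import Data.Bool.ListAction using (any)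
open import Data.Bool.Properties
  using (xor-∧-commutativeRing; xor-same; xor-comm; xor-assoc; xor-identityʳ; xor-annihilates-not;
         not-distribˡ-xor; not-involutive; ∧-zeroʳ; ∧-identityʳ; ∧-comm; ∧-conicalˡ;
         ∧-distribˡ-xor; ∧-distribʳ-xor; ∨-zeroʳ; if-eta)
open import Data.Fin using (Fin; zero; suc; toℕ)
open import Data.Fin.Properties using (_≟_; suc-injective)
open import Data.Fin.Subset using (Subset; ∣_∣)
open import Data.Fin.Subset.Properties using (_∈?_)
open import Data.List using (List; []; _∷_; _++_; length; allFin; map; tabulate)
open import Data.List.Membership.Propositional using (_∈_)
open import Data.List.Properties using (map-tabulate)
open import Data.List.Relation.Unary.All using (All; []; _∷_)
open import Data.List.Relation.Unary.All.Properties using (++⁺)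
open import Data.List.Relation.Unary.Any using (here; there)
open import Data.Maybe using (Maybe; just; nothing)
open import Data.Nat using (ℕ; zero; suc; _+_; _∸_; _%_; _≤_; _<_; _<ᵇ_; z≤n; s≤s)
open import Data.Nat.Combinatorics using (_C_; nCk+nC[k+1]≡[n+1]C[k+1]; nC1≡n)
open import Data.Nat.DivMod using (m%n<n)
open import Data.Nat.ListAction using (sum)
open import Data.Nat.Properties
  using (≤-trans; ≤-pred; ≤-reflexive; +-assoc; +-suc; +-identityʳ; +-mono-≤; +-monoˡ-≤; +-monoʳ-≤;
         m≤m+n; m≤n+m; m∸n≤m; m∸n+n≡m; m+[n∸m]≡n)
open import Data.Product using (Σ; Σ-syntax; _×_; _,_)
open import Data.Sum using (_⊎_; inj₁; inj₂)
open import Data.Vec as Vec using ([]; _∷_)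
open import Function using (_∘_; id; case_of_)
open import Function.Bundles using (_⇔_; mk⇔; Equivalence)
open import Function.Properties.Equivalence using () renaming (trans to ⇔-trans)
open import Relation.Binary.PropositionalEquality
open import Relation.Nullary using (does; yes; no; contradiction)
open import Relation.Nullary.Decidable using (dec-true; dec-false)
open import Tactic.RingSolver using (solve-∀)
open import Tactic.RingSolver.Core.AlmostCommutativeRing using (AlmostCommutativeRing; fromCommutativeRing)
open import Algebra.Properties.CommutativeSemigroup
  (CommutativeRing.+-commutativeSemigroup xor-∧-commutativeRing)
  using () renaming (interchange to xor-interchange)

private
  variable
    n m p : ℕ

GF₂ : AlmostCommutativeRing _ _
GF₂ = fromCommutativeRing xor-∧-commutativeRing isZero
  where
  isZero : ∀ x → Maybe (false ≡ x)
  isZero false = just refl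
  isZero true  = nothing

≡⇒xor≡false : {x y : Bool} → x ≡ y → x xor y ≡ false
≡⇒xor≡false {x} refl = xor-same x

xor≡false⇒≡ : {x y : Bool} → x xor y ≡ false → x ≡ y
xor≡false⇒≡ {false} {false} _ = refl
xor≡false⇒≡ {true}  {true}  _ = refl

_==_ : Fin n → Fin n → Bool
i == j = does (i ≟ j)

==-refl : (i : Fin n) → (i == i) ≡ true
==-refl i = dec-true (i ≟ i) refl

==-≢ : {i j : Fin n} → i ≢ j → (i == j) ≡ false
==-≢ {i = i} {j} = dec-false (i ≟ j)

==-sym : (i j : Fin n) → (i == j) ≡ (j == i)
==-sym i j with i ≟ j | j ≟ i
... | yes _ | yes _ = refl
... | no  _ | no  _ = refl
... | yes i≡j | no j≢i = contradiction (sym i≡j) j≢i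
... | no i≢j | yes j≡i = contradiction (sym j≡i) i≢j

_≺_ : Fin n → Fin n → Bool
i ≺ j = toℕ i <ᵇ toℕ j

≺-irrefl : (i : Fin n) → (i ≺ i) ≡ false
≺-irrefl zero    = refl
≺-irrefl (suc i) = ≺-irrefl i

≺-trichotomy : (i j : Fin n) → (i ≺ j) xor (j ≺ i) ≡ not (i == j)
≺-trichotomy zero    zero    = refl
≺-trichotomy zero    (suc j) = refl
≺-trichotomy (suc i) zero    = refl
≺-trichotomy (suc i) (suc j) = ≺-trichotomy i j

≺⇒≢ : {i j : Fin n} → (i ≺ j) ≡ true → i ≢ j
≺⇒≢ {i = i} i≺j refl with () ← trans (sym (≺-irrefl i)) i≺j

⨁ : (Fin n → Bool) → Bool
⨁ {zero}  f = false
⨁ {suc n} f = f zero xor ⨁ (λ i → f (suc i))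

⨁-cong : {f g : Fin n → Bool} → (∀ i → f i ≡ g i) → ⨁ f ≡ ⨁ g
⨁-cong {zero}  _   = refl
⨁-cong {suc n} f≗g = cong₂ _xor_ (f≗g zero) (⨁-cong (f≗g ∘ suc))

⨁-false : (f : Fin n → Bool) → (∀ i → f i ≡ false) → ⨁ f ≡ false
⨁-false {zero}  f _ = refl
⨁-false {suc n} f f≗false rewrite f≗false zero = ⨁-false (f ∘ suc) (f≗false ∘ suc)

⨁-xor : (f g : Fin n → Bool) → ⨁ (λ i → f i xor g i) ≡ ⨁ f xor ⨁ g
⨁-xor {zero}  f g = refl
⨁-xor {suc n} f g = begin
  (f zero xor g zero) xor ⨁ (λ i → f (suc i) xor g (suc i))
    ≡⟨ cong ((f zero xor g zero) xor_) (⨁-xor (f ∘ suc) (g ∘ suc)) ⟩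
  (f zero xor g zero) xor (⨁ (f ∘ suc) xor ⨁ (g ∘ suc))
    ≡⟨ xor-interchange (f zero) (g zero) _ _ ⟩
  (f zero xor ⨁ (f ∘ suc)) xor (g zero xor ⨁ (g ∘ suc)) ∎
  where open ≡-Reasoning

⨁-∧ˡ : (b : Bool) (f : Fin n → Bool) → ⨁ (λ i → b ∧ f i) ≡ b ∧ ⨁ f
⨁-∧ˡ true  f = refl
⨁-∧ˡ false f = ⨁-false (λ i → false ∧ f i) (λ _ → refl)

⨁-∧ʳ : (f : Fin n → Bool) (b : Bool) → ⨁ (λ i → f i ∧ b) ≡ ⨁ f ∧ b
⨁-∧ʳ f b = begin
  ⨁ (λ i → f i ∧ b) ≡⟨ ⨁-cong (λ i → ∧-comm (f i) b) ⟩
  ⨁ (λ i → b ∧ f i) ≡⟨ ⨁-∧ˡ b f ⟩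
  b ∧ ⨁ f           ≡⟨ ∧-comm b (⨁ f) ⟩
  ⨁ f ∧ b           ∎
  where open ≡-Reasoning

⨁-swap : (f : Fin n → Fin m → Bool) → ⨁ (λ i → ⨁ (f i)) ≡ ⨁ (λ j → ⨁ (λ i → f i j))
⨁-swap {zero} {m} f = sym (⨁-false {m} (λ _ → false) (λ _ → refl))
⨁-swap {suc n} f = begin
  ⨁ (f zero) xor ⨁ (λ i → ⨁ (f (suc i)))      ≡⟨ cong (⨁ (f zero) xor_) (⨁-swap (f ∘ suc)) ⟩
  ⨁ (f zero) xor ⨁ (λ j → ⨁ (λ i → f (suc i) j)) ≡⟨ ⨁-xor (f zero) _ ⟨
  ⨁ (λ j → ⨁ (λ i → f i j))                    ∎
  where open ≡-Reasoning

⨁-indicator : (k : Fin n) (f : Fin n → Bool) → ⨁ (λ i → (i == k) ∧ f i) ≡ f k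
⨁-indicator {suc n} zero    f = trans (cong (f zero xor_) (⨁-false {n} (λ _ → false) (λ _ → refl))) (xor-identityʳ (f zero))
⨁-indicator {suc n} (suc k) f = ⨁-indicator k (f ∘ suc)

⨁-indicatorˡ : (k : Fin n) (f : Fin n → Bool) → ⨁ (λ i → (k == i) ∧ f i) ≡ f k
⨁-indicatorˡ k f = trans (⨁-cong (λ i → cong (_∧ f i) (==-sym k i))) (⨁-indicator k f)

⨁-except : (k : Fin n) (f : Fin n → Bool) → ⨁ (λ i → not (i == k) ∧ f i) ≡ ⨁ f xor f k
⨁-except k f = begin
  ⨁ (λ i → not (i == k) ∧ f i)             ≡⟨ ⨁-cong (λ i → not-∧ (i == k) (f i)) ⟩
  ⨁ (λ i → f i xor ((i == k) ∧ f i))       ≡⟨ ⨁-xor f _ ⟩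
  ⨁ f xor ⨁ (λ i → (i == k) ∧ f i)         ≡⟨ cong (⨁ f xor_) (⨁-indicator k f) ⟩
  ⨁ f xor f k                              ∎
  where
  open ≡-Reasoning
  not-∧ : ∀ x y → not x ∧ y ≡ y xor (x ∧ y)
  not-∧ false y = sym (xor-identityʳ y)
  not-∧ true  y = sym (xor-same y)

⨁-∧-xor : (c f : Fin n → Bool) (y : Bool) → ⨁ (λ a → c a ∧ (f a xor y)) ≡ ⨁ (λ a → c a ∧ f a) xor (⨁ c ∧ y)
⨁-∧-xor c f y = begin
  ⨁ (λ a → c a ∧ (f a xor y))              ≡⟨ ⨁-cong (λ a → ∧-distribˡ-xor (c a) (f a) y) ⟩
  ⨁ (λ a → (c a ∧ f a) xor (c a ∧ y))      ≡⟨ ⨁-xor (λ a → c a ∧ f a) (λ a → c a ∧ y) ⟩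
  ⨁ (λ a → c a ∧ f a) xor ⨁ (λ a → c a ∧ y) ≡⟨ cong (⨁ (λ a → c a ∧ f a) xor_) (⨁-∧ʳ c y) ⟩
  ⨁ (λ a → c a ∧ f a) xor (⨁ c ∧ y)        ∎
  where open ≡-Reasoning

⨁-except-last : (d : Fin n → Bool) → ⨁ d ≡ false → (∀ i → suc (toℕ i) < n → d i ≡ false) →
                ∀ i → d i ≡ false
⨁-except-last {suc zero}    d total _     zero    = trans (sym (xor-identityʳ (d zero))) total
⨁-except-last {suc (suc n)} d total early zero    = early zero (s≤s (s≤s z≤n))
⨁-except-last {suc (suc n)} d total early (suc i) =
  ⨁-except-last (d ∘ suc) (trans (cong (_xor ⨁ (d ∘ suc)) (sym (early zero (s≤s (s≤s z≤n))))) total)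
                (λ i i<n → early (suc i) (s≤s i<n)) i

odd : ℕ → Bool
odd zero    = false
odd (suc n) = not (odd n)

odd-+ : ∀ m n → odd (m + n) ≡ odd m xor odd n
odd-+ zero    n = refl
odd-+ (suc m) n = trans (cong not (odd-+ m n)) (not-distribˡ-xor (odd m) (odd n))

odd-b2n : ∀ b → odd (b2n b) ≡ b
odd-b2n true  = refl
odd-b2n false = refl

odd-sum : (f : Fin n → ℕ) → odd (sum (tabulate f)) ≡ ⨁ (odd ∘ f)
odd-sum {zero}  f = refl
odd-sum {suc n} f = trans (odd-+ (f zero) _) (cong (odd (f zero) xor_) (odd-sum (f ∘ suc)))

%2≡b2n∘odd : ∀ n → n % 2 ≡ b2n (odd n)
%2≡b2n∘odd zero          = refl
%2≡b2n∘odd (suc zero)    = refl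
%2≡b2n∘odd (suc (suc n)) = trans (%2≡b2n∘odd n) (cong b2n (sym (not-involutive (odd n))))

b2n-injective : ∀ {x y} → b2n x ≡ b2n y → x ≡ y
b2n-injective {true}  {true}  _ = refl
b2n-injective {false} {false} _ = refl

%2-≡⇒odd-≡ : ∀ {m n} → m % 2 ≡ n % 2 → odd m ≡ odd n
%2-≡⇒odd-≡ {m} {n} eq = b2n-injective (trans (sym (%2≡b2n∘odd m)) (trans eq (%2≡b2n∘odd n)))

odd-≡⇒%2-≡ : ∀ {m n} → odd m ≡ odd n → m % 2 ≡ n % 2
odd-≡⇒%2-≡ {m} {n} eq = trans (%2≡b2n∘odd m) (trans (cong b2n eq) (sym (%2≡b2n∘odd n)))

odd-mod4 : ∀ p → odd (p % 4) ≡ odd p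
odd-mod4 0 = refl
odd-mod4 1 = refl
odd-mod4 2 = refl
odd-mod4 3 = refl
odd-mod4 (suc (suc (suc (suc k)))) =
  trans (odd-mod4 k) (sym (trans (not-involutive _) (not-involutive (odd k))))

odd-C2-suc : ∀ k → odd (suc k C 2) ≡ odd (k C 2) xor odd k
odd-C2-suc k = begin
  odd (suc k C 2)           ≡⟨ cong odd (nCk+nC[k+1]≡[n+1]C[k+1] k 1) ⟨
  odd (k C 1 + k C 2)       ≡⟨ odd-+ (k C 1) (k C 2) ⟩
  odd (k C 1) xor odd (k C 2) ≡⟨ cong (λ m → odd m xor odd (k C 2)) (nC1≡n k) ⟩
  odd k xor odd (k C 2)     ≡⟨ xor-comm (odd k) _ ⟩
  odd (k C 2) xor odd k     ∎
  where open ≡-Reasoning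

odd-C2-mod4 : ∀ p → odd ((p % 4) C 2) ≡ odd (p C 2)
odd-C2-mod4 0 = refl
odd-C2-mod4 1 = refl
odd-C2-mod4 2 = refl
odd-C2-mod4 3 = refl
odd-C2-mod4 (suc (suc (suc (suc k)))) = begin
  odd ((k % 4) C 2)   ≡⟨ odd-C2-mod4 k ⟩
  odd (k C 2)         ≡⟨ period-4 (odd (k C 2)) (odd k) ⟨
  (((odd (k C 2) xor odd k) xor odd (1 + k)) xor odd (2 + k)) xor odd (3 + k)
    ≡⟨ cong (λ x → ((x xor odd (1 + k)) xor odd (2 + k)) xor odd (3 + k)) (odd-C2-suc k) ⟨
  ((odd ((1 + k) C 2) xor odd (1 + k)) xor odd (2 + k)) xor odd (3 + k)
    ≡⟨ cong (λ x → (x xor odd (2 + k)) xor odd (3 + k)) (odd-C2-suc (1 + k)) ⟨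
  (odd ((2 + k) C 2) xor odd (2 + k)) xor odd (3 + k)
    ≡⟨ cong (_xor odd (3 + k)) (odd-C2-suc (2 + k)) ⟨
  odd ((3 + k) C 2) xor odd (3 + k)
    ≡⟨ odd-C2-suc (3 + k) ⟨
  odd ((4 + k) C 2)     ∎
  where
  open ≡-Reasoning
  period-4 : ∀ c o → (((c xor o) xor not o) xor not (not o)) xor not (not (not o)) ≡ c
  period-4 true  true  = refl
  period-4 true  false = refl
  period-4 false true  = refl
  period-4 false false = refl

same-parity⇔ : ∀ {a b x y z} → odd a ≡ x → odd b ≡ y → z ≡ x xor y → (a % 2 ≡ b % 2) ⇔ (z ≡ false)
same-parity⇔ {a} {b} odd-a odd-b z≡ = mk⇔
  (λ a≡b → trans z≡ (≡⇒xor≡false (trans (sym odd-a) (trans (%2-≡⇒odd-≡ {a} {b} a≡b) odd-b))))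
  (λ z≡false → odd-≡⇒%2-≡ {a} {b} (trans odd-a (trans (xor≡false⇒≡ (trans (sym z≡) z≡false)) (sym odd-b))))

-- Graphs over GF(2)

Graph : ℕ → Set
Graph n = Fin n → Fin n → Bool

Symmetric : Graph n → Set
Symmetric G = ∀ i j → G i j ≡ G j i

Loopless : Graph n → Set
Loopless G = ∀ i → G i i ≡ false

infix 4 _≐_
_≐_ : Graph n → Graph n → Set
G ≐ H = ∀ i j → G i j ≡ H i j

∅ : Graph n
∅ i j = false

infixr 5 _⊕_
_⊕_ : Graph n → Graph n → Graph n
(G ⊕ H) i j = G i j xor H i j

infixr 6 _·_
_·_ : Bool → Graph n → Graph n
(c · G) i j = c ∧ G i j

⨁ᴳ : (Fin m → Graph n) → Graph n
⨁ᴳ G i j = ⨁ (λ a → G a i j)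

oddDegree : Graph n → Fin n → Bool
oddDegree G i = ⨁ (G i)

oddSize : Graph n → Bool
oddSize G = ⨁ (λ i → ⨁ (λ j → (i ≺ j) ∧ G i j))

oddDegree-cong : {G H : Graph n} → G ≐ H → ∀ i → oddDegree G i ≡ oddDegree H i
oddDegree-cong G≐H i = ⨁-cong (G≐H i)

oddSize-cong : {G H : Graph n} → G ≐ H → oddSize G ≡ oddSize H
oddSize-cong G≐H = ⨁-cong (λ i → ⨁-cong (λ j → cong (_ ∧_) (G≐H i j)))

oddDegree-⊕ : (G H : Graph n) (i : Fin n) → oddDegree (G ⊕ H) i ≡ oddDegree G i xor oddDegree H i
oddDegree-⊕ G H i = ⨁-xor (G i) (H i)

oddSize-⊕ : (G H : Graph n) → oddSize (G ⊕ H) ≡ oddSize G xor oddSize H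
oddSize-⊕ G H = begin
  ⨁ (λ i → ⨁ (λ j → (i ≺ j) ∧ (G i j xor H i j)))
    ≡⟨ ⨁-cong (λ i → ⨁-cong (λ j → ∧-distribˡ-xor (i ≺ j) (G i j) (H i j))) ⟩
  ⨁ (λ i → ⨁ (λ j → ((i ≺ j) ∧ G i j) xor ((i ≺ j) ∧ H i j)))
    ≡⟨ ⨁-cong (λ i → ⨁-xor (λ j → (i ≺ j) ∧ G i j) (λ j → (i ≺ j) ∧ H i j)) ⟩
  ⨁ (λ i → ⨁ (λ j → (i ≺ j) ∧ G i j) xor ⨁ (λ j → (i ≺ j) ∧ H i j))
    ≡⟨ ⨁-xor (λ i → ⨁ (λ j → (i ≺ j) ∧ G i j)) (λ i → ⨁ (λ j → (i ≺ j) ∧ H i j)) ⟩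
  oddSize G xor oddSize H ∎
  where open ≡-Reasoning

oddDegree-· : (c : Bool) (G : Graph n) (i : Fin n) → oddDegree (c · G) i ≡ c ∧ oddDegree G i
oddDegree-· c G i = ⨁-∧ˡ c (G i)

oddSize-· : (c : Bool) (G : Graph n) → oddSize (c · G) ≡ c ∧ oddSize G
oddSize-· true  G = refl
oddSize-· {n} false G = ⨁-false {n} _ (λ i → ⨁-false (λ j → (i ≺ j) ∧ false) (λ j → ∧-zeroʳ (i ≺ j)))

oddDegree-⨁ᴳ : (G : Fin m → Graph n) (i : Fin n) → oddDegree (⨁ᴳ G) i ≡ ⨁ (λ a → oddDegree (G a) i)
oddDegree-⨁ᴳ G i = sym (⨁-swap (λ a → G a i))

oddSize-⨁ᴳ : (G : Fin m → Graph n) → oddSize (⨁ᴳ G) ≡ ⨁ (λ a → oddSize (G a))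
oddSize-⨁ᴳ G = begin
  ⨁ (λ i → ⨁ (λ j → (i ≺ j) ∧ ⨁ (λ a → G a i j)))
    ≡⟨ ⨁-cong (λ i → ⨁-cong (λ j → ⨁-∧ˡ (i ≺ j) (λ a → G a i j))) ⟨
  ⨁ (λ i → ⨁ (λ j → ⨁ (λ a → (i ≺ j) ∧ G a i j)))
    ≡⟨ ⨁-cong (λ i → ⨁-swap (λ j a → (i ≺ j) ∧ G a i j)) ⟩
  ⨁ (λ i → ⨁ (λ a → ⨁ (λ j → (i ≺ j) ∧ G a i j)))
    ≡⟨ ⨁-swap (λ i a → ⨁ (λ j → (i ≺ j) ∧ G a i j)) ⟩
  ⨁ (λ a → oddSize (G a)) ∎
  where open ≡-Reasoning

split-by-order : {G : Graph n} → Loopless G → ∀ i j → G i j ≡ ((i ≺ j) ∧ G i j) xor ((j ≺ i) ∧ G i j)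
split-by-order {G = G} loopless i j = begin
  G i j                                ≡⟨ off-diagonal ⟨
  not (i == j) ∧ G i j                 ≡⟨ cong (_∧ G i j) (≺-trichotomy i j) ⟨
  ((i ≺ j) xor (j ≺ i)) ∧ G i j        ≡⟨ ∧-distribʳ-xor (G i j) (i ≺ j) (j ≺ i) ⟩
  ((i ≺ j) ∧ G i j) xor ((j ≺ i) ∧ G i j) ∎
  where
  open ≡-Reasoning
  off-diagonal : not (i == j) ∧ G i j ≡ G i j
  off-diagonal with i ≟ j
  ... | yes refl = sym (loopless i)
  ... | no  _    = refl

handshake : {G : Graph n} → Symmetric G → Loopless G → ⨁ (oddDegree G) ≡ false
handshake {G = G} symmetric loopless = begin
  ⨁ (λ i → ⨁ (G i))
    ≡⟨ ⨁-cong (λ i → ⨁-cong (split-by-order loopless i)) ⟩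
  ⨁ (λ i → ⨁ (λ j → ((i ≺ j) ∧ G i j) xor ((j ≺ i) ∧ G i j)))
    ≡⟨ ⨁-cong (λ i → ⨁-xor (λ j → (i ≺ j) ∧ G i j) (λ j → (j ≺ i) ∧ G i j)) ⟩
  ⨁ (λ i → ⨁ (λ j → (i ≺ j) ∧ G i j) xor ⨁ (λ j → (j ≺ i) ∧ G i j))
    ≡⟨ ⨁-xor (λ i → ⨁ (λ j → (i ≺ j) ∧ G i j)) (λ i → ⨁ (λ j → (j ≺ i) ∧ G i j)) ⟩
  oddSize G xor ⨁ (λ i → ⨁ (λ j → (j ≺ i) ∧ G i j))
    ≡⟨ cong (oddSize G xor_) (⨁-swap (λ i j → (j ≺ i) ∧ G i j)) ⟩
  oddSize G xor ⨁ (λ j → ⨁ (λ i → (j ≺ i) ∧ G i j))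
    ≡⟨ cong (oddSize G xor_) (⨁-cong (λ j → ⨁-cong (λ i → cong ((j ≺ i) ∧_) (symmetric i j)))) ⟩
  oddSize G xor oddSize G
    ≡⟨ xor-same (oddSize G) ⟩
  false ∎
  where open ≡-Reasoning

-- Sums of cliques

mem-suc : (i : Fin n) (x : Bool) (X : Subset n) → mem (suc i) (x ∷ X) ≡ mem i X
mem-suc i x X with i ∈? X
... | yes _ = refl
... | no  _ = refl

⨁-mem : (X : Subset n) → ⨁ (λ i → mem i X) ≡ odd ∣ X ∣
⨁-mem []          = refl
⨁-mem (true  ∷ X) = cong not (trans (⨁-cong (λ i → mem-suc i true X)) (⨁-mem X))
⨁-mem (false ∷ X) = trans (⨁-cong (λ i → mem-suc i false X)) (⨁-mem X)

clique : Subset n → Graph n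
clique X i j = mem i X ∧ mem j X ∧ not (i == j)

oddDegree-clique : (X : Subset n) (i : Fin n) → oddDegree (clique X) i ≡ mem i X ∧ not (odd ∣ X ∣)
oddDegree-clique X i = begin
  ⨁ (λ j → mem i X ∧ mem j X ∧ not (i == j))
    ≡⟨ ⨁-∧ˡ (mem i X) (λ j → mem j X ∧ not (i == j)) ⟩
  mem i X ∧ ⨁ (λ j → mem j X ∧ not (i == j))
    ≡⟨ cong (mem i X ∧_) (⨁-cong λ j → trans (∧-comm (mem j X) _) (cong (λ b → not b ∧ mem j X) (==-sym i j))) ⟩
  mem i X ∧ ⨁ (λ j → not (j == i) ∧ mem j X)
    ≡⟨ cong (mem i X ∧_) (⨁-except i (λ j → mem j X)) ⟩
  mem i X ∧ (⨁ (λ j → mem j X) xor mem i X)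
    ≡⟨ cong (λ b → mem i X ∧ (b xor mem i X)) (⨁-mem X) ⟩
  mem i X ∧ (odd ∣ X ∣ xor mem i X)
    ≡⟨ absorb (mem i X) (odd ∣ X ∣) ⟩
  mem i X ∧ not (odd ∣ X ∣) ∎
  where
  open ≡-Reasoning
  absorb : ∀ x y → x ∧ (y xor x) ≡ x ∧ not y
  absorb false y = refl
  absorb true  y = xor-comm y true

oddSize-clique : (X : Subset n) → oddSize (clique X) ≡ odd (∣ X ∣ C 2)
oddSize-clique []      = refl
oddSize-clique {suc n} (x ∷ X) = begin
  oddSize (clique (x ∷ X))                 ≡⟨ cong₂ _xor_ (first-row x) (⨁-cong other-rows) ⟩
  (x ∧ odd ∣ X ∣) xor oddSize (clique X)   ≡⟨ cong ((x ∧ odd ∣ X ∣) xor_) (oddSize-clique X) ⟩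
  (x ∧ odd ∣ X ∣) xor odd (∣ X ∣ C 2)      ≡⟨ pascal x ⟩
  odd (∣ x ∷ X ∣ C 2)                      ∎
  where
  open ≡-Reasoning
  first-row : ∀ x → ⨁ (λ j → (zero ≺ j) ∧ clique (x ∷ X) zero j) ≡ x ∧ odd ∣ X ∣
  first-row false = ⨁-false {n} (λ j → false) (λ _ → refl)
  first-row true  = trans (⨁-cong (λ j → trans (∧-identityʳ _) (mem-suc j true X))) (⨁-mem X)
  other-rows : ∀ i → ⨁ (λ j → (suc i ≺ j) ∧ clique (x ∷ X) (suc i) j) ≡ ⨁ (λ j → (i ≺ j) ∧ clique X i j)
  other-rows i = ⨁-cong (λ j → cong₂ (λ a b → (i ≺ j) ∧ a ∧ b ∧ not (i == j)) (mem-suc i x X) (mem-suc j x X))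
  pascal : ∀ x → (x ∧ odd ∣ X ∣) xor odd (∣ X ∣ C 2) ≡ odd (∣ x ∷ X ∣ C 2)
  pascal false = refl
  pascal true  = trans (xor-comm (odd ∣ X ∣) _) (sym (odd-C2-suc ∣ X ∣))

clique-symmetric : (X : Subset n) → Symmetric (clique X)
clique-symmetric X i j = trans (swap (mem i X) (mem j X) (not (i == j))) (cong (λ b → mem j X ∧ mem i X ∧ not b) (==-sym i j))
  where
  swap : ∀ x y z → x ∧ (y ∧ z) ≡ y ∧ (x ∧ z)
  swap = solve-∀ GF₂

clique-loopless : (X : Subset n) → Loopless (clique X)
clique-loopless X i rewrite ==-refl i = trans (cong (mem i X ∧_) (∧-zeroʳ (mem i X))) (∧-zeroʳ (mem i X))

cliqueSum : List (Subset n) → Graph n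
cliqueSum []       = ∅
cliqueSum (X ∷ Xs) = clique X ⊕ cliqueSum Xs

cliqueSum-symmetric : (Xs : List (Subset n)) → Symmetric (cliqueSum Xs)
cliqueSum-symmetric []       i j = refl
cliqueSum-symmetric (X ∷ Xs) i j = cong₂ _xor_ (clique-symmetric X i j) (cliqueSum-symmetric Xs i j)

cliqueSum-loopless : (Xs : List (Subset n)) → Loopless (cliqueSum Xs)
cliqueSum-loopless []       i = refl
cliqueSum-loopless (X ∷ Xs) i = cong₂ _xor_ (clique-loopless X i) (cliqueSum-loopless Xs i)

cliqueSum-++ : (Xs Ys : List (Subset n)) → cliqueSum (Xs ++ Ys) ≐ cliqueSum Xs ⊕ cliqueSum Ys
cliqueSum-++ []       Ys i j = refl
cliqueSum-++ (X ∷ Xs) Ys i j =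
  trans (cong (clique X i j xor_) (cliqueSum-++ Xs Ys i j)) (sym (xor-assoc (clique X i j) _ _))

cliqueSum-evenDegrees : odd p ≡ true → (Xs : List (Subset n)) → All (λ X → ∣ X ∣ ≡ p) Xs →
                        ∀ i → oddDegree (cliqueSum Xs) i ≡ false
cliqueSum-evenDegrees p-odd []       []         i = ⨁-false (cliqueSum [] i) (λ _ → refl)
cliqueSum-evenDegrees p-odd (X ∷ Xs) (∣X∣≡p ∷ ps) i = begin
  oddDegree (clique X ⊕ cliqueSum Xs) i                    ≡⟨ oddDegree-⊕ (clique X) (cliqueSum Xs) i ⟩
  oddDegree (clique X) i xor oddDegree (cliqueSum Xs) i
    ≡⟨ cong₂ _xor_ (oddDegree-clique X i) (cliqueSum-evenDegrees p-odd Xs ps i) ⟩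
  (mem i X ∧ not (odd ∣ X ∣)) xor false
    ≡⟨ cong (λ b → (mem i X ∧ not b) xor false) (trans (cong odd ∣X∣≡p) p-odd) ⟩
  (mem i X ∧ false) xor false                              ≡⟨ cong (_xor false) (∧-zeroʳ (mem i X)) ⟩
  false                                                    ∎
  where open ≡-Reasoning

cliqueSum-evenSize : odd (p C 2) ≡ false → (Xs : List (Subset n)) → All (λ X → ∣ X ∣ ≡ p) Xs →
                     oddSize (cliqueSum Xs) ≡ false
cliqueSum-evenSize {n = n} pC2-even [] [] =
  ⨁-false {n} _ (λ i → ⨁-false (λ j → (i ≺ j) ∧ false) (λ j → ∧-zeroʳ (i ≺ j)))
cliqueSum-evenSize {p = p} pC2-even (X ∷ Xs) (∣X∣≡p ∷ ps) = begin
  oddSize (clique X ⊕ cliqueSum Xs)                  ≡⟨ oddSize-⊕ (clique X) (cliqueSum Xs) ⟩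
  oddSize (clique X) xor oddSize (cliqueSum Xs)      ≡⟨ cong₂ _xor_ (oddSize-clique X) (cliqueSum-evenSize pC2-even Xs ps) ⟩
  odd (∣ X ∣ C 2) xor false                          ≡⟨ cong (λ k → odd (k C 2) xor false) ∣X∣≡p ⟩
  odd (p C 2) xor false                              ≡⟨ cong (_xor false) pC2-even ⟩
  false                                              ∎
  where open ≡-Reasoning

IsCliqueSum : ℕ → Graph n → Set
IsCliqueSum {n} p G = Σ[ Xs ∈ List (Subset n) ] All (λ X → ∣ X ∣ ≡ p) Xs × G ≐ cliqueSum Xs

∅-isCliqueSum : IsCliqueSum {n} p ∅
∅-isCliqueSum = [] , [] , λ _ _ → refl

clique-isCliqueSum : {X : Subset n} → ∣ X ∣ ≡ p → IsCliqueSum p (clique X)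
clique-isCliqueSum {X = X} ∣X∣≡p = X ∷ [] , ∣X∣≡p ∷ [] , λ i j → sym (xor-identityʳ (clique X i j))

isCliqueSum-resp : {G H : Graph n} → G ≐ H → IsCliqueSum p H → IsCliqueSum p G
isCliqueSum-resp G≐H (Xs , sizes , H≐) = Xs , sizes , λ i j → trans (G≐H i j) (H≐ i j)

⊕-isCliqueSum : {G H : Graph n} → IsCliqueSum p G → IsCliqueSum p H → IsCliqueSum p (G ⊕ H)
⊕-isCliqueSum (Xs , Xs-sizes , G≐) (Ys , Ys-sizes , H≐) =
  Xs ++ Ys , ++⁺ Xs-sizes Ys-sizes , λ i j → trans (cong₂ _xor_ (G≐ i j) (H≐ i j)) (sym (cliqueSum-++ Xs Ys i j))

·-isCliqueSum : (c : Bool) {G : Graph n} → (c ≡ true → IsCliqueSum p G) → IsCliqueSum p (c · G)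
·-isCliqueSum true  G-sum = G-sum refl
·-isCliqueSum false _     = ∅-isCliqueSum

⨁ᴳ-isCliqueSum : {G : Fin m → Graph n} → (∀ a → IsCliqueSum p (G a)) → IsCliqueSum p (⨁ᴳ G)
⨁ᴳ-isCliqueSum {zero}  _     = ∅-isCliqueSum
⨁ᴳ-isCliqueSum {suc m} G-sum = ⊕-isCliqueSum (G-sum zero) (⨁ᴳ-isCliqueSum (G-sum ∘ suc))

isCliqueSum-offDiagonal : {G H : Graph n} → Loopless G → (∀ i j → i ≢ j → G i j ≡ H i j) →
                          IsCliqueSum p H → IsCliqueSum p G
isCliqueSum-offDiagonal {G = G} loopless G≡H (Xs , sizes , H≐) = Xs , sizes , G≐
  where
  G≐ : G ≐ cliqueSum Xs
  G≐ i j with i ≟ j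
  ... | yes refl = trans (loopless i) (sym (cliqueSum-loopless Xs i))
  ... | no  i≢j  = trans (G≡H i j i≢j) (H≐ i j)

isCliqueSum-evenDegrees : odd p ≡ true → {G : Graph n} → IsCliqueSum p G → ∀ i → oddDegree G i ≡ false
isCliqueSum-evenDegrees p-odd (Xs , sizes , G≐) i =
  trans (oddDegree-cong G≐ i) (cliqueSum-evenDegrees p-odd Xs sizes i)

isCliqueSum-evenSize : odd (p C 2) ≡ false → {G : Graph n} → IsCliqueSum p G → oddSize G ≡ false
isCliqueSum-evenSize pC2-even (Xs , sizes , G≐) =
  trans (oddSize-cong G≐) (cliqueSum-evenSize pC2-even Xs sizes)

count : (Fin n → Bool) → ℕ
count {zero}  f = 0
count {suc n} f = b2n (f zero) + count (f ∘ suc)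

count-≤ : (f : Fin n → Bool) → count f ≤ n
count-≤ {zero}  f = z≤n
count-≤ {suc n} f = +-mono-≤ (b2n≤1 (f zero)) (count-≤ (f ∘ suc))
  where
  b2n≤1 : ∀ b → b2n b ≤ 1
  b2n≤1 true  = s≤s z≤n
  b2n≤1 false = z≤n

count-∨-== : (u : Fin n) (g : Fin n → Bool) → count (λ i → (i == u) ∨ g i) ≤ suc (count g)
count-∨-== {suc n} zero    g = s≤s (m≤n+m (count (g ∘ suc)) (b2n (g zero)))
count-∨-== {suc n} (suc u) g = ≤-trans (+-monoʳ-≤ (b2n (g zero)) (count-∨-== u (g ∘ suc)))
                                          (≤-reflexive (+-suc (b2n (g zero)) _))

_∈ᵇ_ : Fin n → List (Fin n) → Bool
i ∈ᵇ us = any (i ==_) us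

count-∈ᵇ : (us : List (Fin n)) → count (_∈ᵇ us) ≤ length us
count-∈ᵇ {n} []       = ≤-reflexive (count-false {n} (_∈ᵇ []) (λ _ → refl))
  where
  count-false : ∀ {m} (f : Fin m → Bool) → (∀ i → f i ≡ false) → count f ≡ 0
  count-false {zero}  f _ = refl
  count-false {suc m} f f≡false rewrite f≡false zero = count-false (f ∘ suc) (f≡false ∘ suc)
count-∈ᵇ (u ∷ us) = ≤-trans (count-∨-== u (_∈ᵇ us)) (s≤s (count-∈ᵇ us))

∈⇒∈ᵇ : {u : Fin n} {us : List (Fin n)} → u ∈ us → (u ∈ᵇ us) ≡ true
∈⇒∈ᵇ {u = u} (here refl) rewrite ==-refl u = refl
∈⇒∈ᵇ {u = u} (there {x = v} u∈us) = trans (cong ((u == v) ∨_) (∈⇒∈ᵇ u∈us)) (∨-zeroʳ (u == v))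

private
  pick : Bool → ℕ → Bool
  pick false (suc _) = true
  pick _     _       = false

-- The first k vertices (in the order of Fin n) on which bad is false.
avoiding : ℕ → (Fin n → Bool) → Fin n → Bool
avoiding k bad zero    = pick (bad zero) k
avoiding k bad (suc i) = avoiding (k ∸ b2n (pick (bad zero) k)) (bad ∘ suc) i

avoiding-avoids : (k : ℕ) (bad : Fin n → Bool) {i : Fin n} → bad i ≡ true → avoiding k bad i ≡ false
avoiding-avoids k bad {zero}  bad-i rewrite bad-i = refl
avoiding-avoids k bad {suc i} bad-i = avoiding-avoids _ (bad ∘ suc) bad-i

count-avoiding : (k : ℕ) (bad : Fin n → Bool) → k + count bad ≤ n → count (avoiding k bad) ≡ k
count-avoiding {zero}  zero    bad _  = refl
count-avoiding {zero}  (suc k) bad ()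
count-avoiding {suc n} k bad room with bad zero
... | true  = count-avoiding k (bad ∘ suc) (≤-pred (subst (_≤ suc n) (+-suc k _) room))
... | false with k
...   | zero  = count-avoiding 0 (bad ∘ suc) (count-≤ (bad ∘ suc))
...   | suc k = cong suc (count-avoiding k (bad ∘ suc) (≤-pred room))

fresh : ℕ → List (Fin n) → Fin n → Bool
fresh k us = avoiding k (_∈ᵇ us)

fresh-∉ : (k : ℕ) (us : List (Fin n)) {u : Fin n} → u ∈ us → fresh k us u ≡ false
fresh-∉ k us {u} u∈us = avoiding-avoids k (_∈ᵇ us) {u} (∈⇒∈ᵇ u∈us)

count-fresh : (k : ℕ) (us : List (Fin n)) → k + length us ≤ n → count (fresh k us) ≡ k
count-fresh k us room = count-avoiding k (_∈ᵇ us) (≤-trans (+-monoʳ-≤ k (count-∈ᵇ us)) room)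

toggle : Fin n → (Fin n → Bool) → Fin n → Bool
toggle u f i = f i xor (i == u)

toggle-≢ : {u i : Fin n} → i ≢ u → (f : Fin n → Bool) → toggle u f i ≡ f i
toggle-≢ i≢u f = trans (cong (f _ xor_) (==-≢ i≢u)) (xor-identityʳ (f _))

count-cong : {f g : Fin n → Bool} → (∀ i → f i ≡ g i) → count f ≡ count g
count-cong {zero}  _   = refl
count-cong {suc n} f≗g = cong₂ _+_ (cong b2n (f≗g zero)) (count-cong (f≗g ∘ suc))

count-toggle : (u : Fin n) (f : Fin n → Bool) → f u ≡ false → count (toggle u f) ≡ suc (count f)
count-toggle {suc n} zero    f f0≡false rewrite f0≡false =
  cong suc (count-cong (λ i → xor-identityʳ (f (suc i))))
count-toggle {suc n} (suc u) f fu≡false = begin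
  b2n (f zero xor false) + count (toggle u (f ∘ suc)) ≡⟨ cong₂ _+_ (cong b2n (xor-identityʳ (f zero)))
                                                                 (count-toggle u (f ∘ suc) fu≡false) ⟩
  b2n (f zero) + suc (count (f ∘ suc))                ≡⟨ +-suc (b2n (f zero)) _ ⟩
  suc (count f)                                       ∎
  where open ≡-Reasoning

fromPred : (Fin n → Bool) → Subset n
fromPred = Vec.tabulate

mem-fromPred : (f : Fin n → Bool) (i : Fin n) → mem i (fromPred f) ≡ f i
mem-fromPred {suc n} f zero    with f zero
... | true  = refl
... | false = refl
mem-fromPred {suc n} f (suc i) = trans (mem-suc i (f zero) (fromPred (f ∘ suc))) (mem-fromPred (f ∘ suc) i)

∣fromPred∣ : (f : Fin n → Bool) → ∣ fromPred f ∣ ≡ count f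
∣fromPred∣ {zero}  f = refl
∣fromPred∣ {suc n} f with f zero
... | true  = cong suc (∣fromPred∣ (f ∘ suc))
... | false = ∣fromPred∣ (f ∘ suc)

-- Four-cycles and triangles

edge : Fin n → Fin n → Graph n
edge u v i j = ((i == u) ∧ (j == v)) xor ((i == v) ∧ (j == u))

edge-comm : (u v : Fin n) → edge u v ≐ edge v u
edge-comm u v i j = xor-comm ((i == u) ∧ (j == v)) _

edge-loopless : (u v : Fin n) → Loopless (edge u v)
edge-loopless u v i = trans (cong (_xor ((i == v) ∧ (i == u))) (∧-comm (i == u) (i == v))) (xor-same ((i == v) ∧ (i == u)))

fourCycle : Fin n → Fin n → Fin n → Fin n → Graph n
fourCycle w x y z = edge w x ⊕ edge x y ⊕ edge y z ⊕ edge z w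

private
  four-cycle-identity : ∀ r w x y z r′ w′ x′ y′ z′ →
    (((r xor x) xor w) ∧ ((r′ xor x′) xor w′)) xor ((((r xor x) xor y) ∧ ((r′ xor x′) xor y′))
      xor ((((r xor z) xor w) ∧ ((r′ xor z′) xor w′)) xor ((((r xor z) xor y) ∧ ((r′ xor z′) xor y′)) xor false)))
    ≡ ((w ∧ x′) xor (x ∧ w′)) xor (((x ∧ y′) xor (y ∧ x′))
      xor (((y ∧ z′) xor (z ∧ y′)) xor ((z ∧ w′) xor (w ∧ z′))))
  four-cycle-identity = solve-∀ GF₂

fourCycle-loopless : (w x y z : Fin n) → Loopless (fourCycle w x y z)
fourCycle-loopless w x y z i rewrite edge-loopless w x i | edge-loopless x y i | edge-loopless y z i | edge-loopless z w i = refl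

clique-fromPred : (f : Fin n → Bool) {i j : Fin n} → i ≢ j → clique (fromPred f) i j ≡ f i ∧ f j
clique-fromPred f {i} {j} i≢j rewrite mem-fromPred f i | mem-fromPred f j | ==-≢ i≢j = cong (f i ∧_) (∧-identityʳ (f j))

-- The four sets are R ∪ {u, v} for u ∈ {x, z} and v ∈ {w, y}, where R is a fixed (p − 2)-set
-- avoiding the cycle: over GF(2) every product involving R occurs an even number of times.
fourCycle-isCliqueSum : 2 ≤ p → p + 2 ≤ n → {w x y z : Fin n} →
                        w ≢ x → x ≢ y → y ≢ z → z ≢ w → IsCliqueSum p (fourCycle w x y z)
fourCycle-isCliqueSum {p} {n} 2≤p room {w} {x} {y} {z} w≢x x≢y y≢z z≢w =
  isCliqueSum-offDiagonal (fourCycle-loopless w x y z) agrees (sets , sizes , λ _ _ → refl)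
  where
  cycle : List (Fin n)
  cycle = w ∷ x ∷ y ∷ z ∷ []

  R : Fin n → Bool
  R = fresh (p ∸ 2) cycle

  S : Fin n → Fin n → Fin n → Bool
  S u v = toggle v (toggle u R)

  sets : List (Subset n)
  sets = fromPred (S x w) ∷ fromPred (S x y) ∷ fromPred (S z w) ∷ fromPred (S z y) ∷ []

  Rw : R w ≡ false
  Rw = fresh-∉ (p ∸ 2) cycle (here refl)
  Rx : R x ≡ false
  Rx = fresh-∉ (p ∸ 2) cycle (there (here refl))
  Ry : R y ≡ false
  Ry = fresh-∉ (p ∸ 2) cycle (there (there (here refl)))
  Rz : R z ≡ false
  Rz = fresh-∉ (p ∸ 2) cycle (there (there (there (here refl))))

  ∣S∣ : ∀ {u v} → R u ≡ false → R v ≡ false → v ≢ u → ∣ fromPred (S u v) ∣ ≡ p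
  ∣S∣ {u} {v} Ru Rv v≢u = begin
    ∣ fromPred (S u v) ∣        ≡⟨ ∣fromPred∣ (S u v) ⟩
    count (S u v)               ≡⟨ count-toggle v (toggle u R) (trans (toggle-≢ v≢u R) Rv) ⟩
    suc (count (toggle u R))    ≡⟨ cong suc (count-toggle u R Ru) ⟩
    2 + count R                 ≡⟨ cong (2 +_) (count-fresh (p ∸ 2) cycle fits) ⟩
    2 + (p ∸ 2)                 ≡⟨ m+[n∸m]≡n 2≤p ⟩
    p                           ∎
    where
    open ≡-Reasoning
    fits : p ∸ 2 + 4 ≤ n
    fits = subst (_≤ n) (trans (cong (_+ 2) (sym (m∸n+n≡m 2≤p))) (+-assoc (p ∸ 2) 2 2)) room

  sizes : All (λ X → ∣ X ∣ ≡ p) sets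
  sizes = ∣S∣ Rx Rw w≢x ∷ ∣S∣ Rx Ry (≢-sym x≢y) ∷ ∣S∣ Rz Rw (≢-sym z≢w) ∷ ∣S∣ Rz Ry y≢z ∷ []

  agrees : ∀ i j → i ≢ j → fourCycle w x y z i j ≡ cliqueSum sets i j
  agrees i j i≢j = sym (begin
    cliqueSum sets i j
      ≡⟨ cong₂ _xor_ (clique-fromPred (S x w) i≢j) (cong₂ _xor_ (clique-fromPred (S x y) i≢j)
           (cong₂ _xor_ (clique-fromPred (S z w) i≢j) (cong (_xor false) (clique-fromPred (S z y) i≢j)))) ⟩
    (S x w i ∧ S x w j) xor ((S x y i ∧ S x y j) xor ((S z w i ∧ S z w j) xor ((S z y i ∧ S z y j) xor false)))
      ≡⟨ four-cycle-identity (R i) (i == w) (i == x) (i == y) (i == z) (R j) (j == w) (j == x) (j == y) (j == z) ⟩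
    fourCycle w x y z i j ∎)
    where open ≡-Reasoning

triangle : Fin n → Fin n → Fin n → Graph n
triangle o a b = edge o a ⊕ edge o b ⊕ edge a b

module _ (2≤p : 2 ≤ p) (room : p + 2 ≤ n) {o : Fin n} where

  adjacent-triangles : {a b c : Fin n} → o ≢ b → o ≢ c → a ≢ b → a ≢ c →
                       IsCliqueSum p (triangle o a b ⊕ triangle o a c)
  adjacent-triangles {a} {b} {c} o≢b o≢c a≢b a≢c =
    isCliqueSum-resp two-triangles (fourCycle-isCliqueSum 2≤p room o≢b (≢-sym a≢b) a≢c (≢-sym o≢c))
    where
    shared-edge-cancels : ∀ oa ob ab oc ac → (oa xor (ob xor ab)) xor (oa xor (oc xor ac)) ≡ ob xor (ab xor (ac xor oc))
    shared-edge-cancels = solve-∀ GF₂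
    two-triangles : triangle o a b ⊕ triangle o a c ≐ fourCycle o b a c
    two-triangles i j = trans (shared-edge-cancels (edge o a i j) (edge o b i j) (edge a b i j) (edge o c i j) (edge a c i j))
      (cong₂ (λ ba co → edge o b i j xor (ba xor (edge a c i j xor co))) (edge-comm a b i j) (edge-comm o c i j))

  triangle-pair : {a b c d : Fin n} → o ≢ a → o ≢ b → o ≢ c → o ≢ d → a ≢ b → c ≢ d →
                  IsCliqueSum p (triangle o a b ⊕ triangle o c d)
  triangle-pair {a} {b} {c} {d} o≢a o≢b o≢c o≢d a≢b c≢d with a ≟ c
  ... | yes refl = adjacent-triangles o≢b o≢d a≢b c≢d
  ... | no  a≢c  = isCliqueSum-resp via-shared-side
                     (⊕-isCliqueSum (adjacent-triangles o≢b o≢c a≢b a≢c)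
                                    (adjacent-triangles o≢a o≢d (≢-sym a≢c) c≢d))
    where
    insert : ∀ x y z → x xor y ≡ (x xor z) xor (z xor y)
    insert = solve-∀ GF₂
    via-shared-side : triangle o a b ⊕ triangle o c d ≐ (triangle o a b ⊕ triangle o a c) ⊕ (triangle o c a ⊕ triangle o c d)
    via-shared-side i j = trans (insert (triangle o a b i j) (triangle o c d i j) (triangle o a c i j))
      (cong (λ t → (triangle o a b i j xor triangle o a c i j) xor (t xor triangle o c d i j)) (triangle-swap i j))
      where
      swap : ∀ x y z → x xor (y xor z) ≡ y xor (x xor z)
      swap = solve-∀ GF₂
      triangle-swap : triangle o a c ≐ triangle o c a
      triangle-swap i j = trans (swap (edge o a i j) (edge o c i j) (edge a c i j))
                                (cong (λ t → edge o c i j xor (edge o a i j xor t)) (edge-comm a c i j))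

⨁²-edge : (c : Fin n → Fin n → Bool) (i j : Fin n) →
          ⨁ (λ a → ⨁ (λ b → c a b ∧ edge a b i j)) ≡ c i j xor c j i
⨁²-edge c i j = begin
  ⨁ (λ a → ⨁ (λ b → c a b ∧ edge a b i j))
    ≡⟨ ⨁-cong (λ a → ⨁-cong (λ b → spread (c a b) (i == a) (j == b) (i == b) (j == a))) ⟩
  ⨁ (λ a → ⨁ (λ b → ((i == a) ∧ ((j == b) ∧ c a b)) xor ((j == a) ∧ ((i == b) ∧ c a b))))
    ≡⟨ ⨁-cong (λ a → ⨁-xor (λ b → (i == a) ∧ ((j == b) ∧ c a b)) (λ b → (j == a) ∧ ((i == b) ∧ c a b))) ⟩
  ⨁ (λ a → ⨁ (λ b → (i == a) ∧ ((j == b) ∧ c a b)) xor ⨁ (λ b → (j == a) ∧ ((i == b) ∧ c a b)))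
    ≡⟨ ⨁-cong (λ a → cong₂ _xor_ (⨁-∧ˡ (i == a) (λ b → (j == b) ∧ c a b))
                                 (⨁-∧ˡ (j == a) (λ b → (i == b) ∧ c a b))) ⟩
  ⨁ (λ a → ((i == a) ∧ ⨁ (λ b → (j == b) ∧ c a b)) xor ((j == a) ∧ ⨁ (λ b → (i == b) ∧ c a b)))
    ≡⟨ ⨁-cong (λ a → cong₂ (λ x y → ((i == a) ∧ x) xor ((j == a) ∧ y))
                           (⨁-indicatorˡ j (c a)) (⨁-indicatorˡ i (c a))) ⟩
  ⨁ (λ a → ((i == a) ∧ c a j) xor ((j == a) ∧ c a i))
    ≡⟨ ⨁-xor (λ a → (i == a) ∧ c a j) (λ a → (j == a) ∧ c a i) ⟩
  ⨁ (λ a → (i == a) ∧ c a j) xor ⨁ (λ a → (j == a) ∧ c a i)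
    ≡⟨ cong₂ _xor_ (⨁-indicatorˡ i (λ a → c a j)) (⨁-indicatorˡ j (λ a → c a i)) ⟩
  c i j xor c j i ∎
  where
  open ≡-Reasoning
  spread : ∀ c x y z w → c ∧ ((x ∧ y) xor (z ∧ w)) ≡ (x ∧ (y ∧ c)) xor (w ∧ (z ∧ c))
  spread = solve-∀ GF₂

⨁²-star : (c : Fin n → Fin n → Bool) (j : Fin n) →
          ⨁ (λ a → ⨁ (λ b → c a b ∧ ((j == a) xor (j == b)))) ≡ ⨁ (λ b → c j b xor c b j)
⨁²-star c j = begin
  ⨁ (λ a → ⨁ (λ b → c a b ∧ ((j == a) xor (j == b))))
    ≡⟨ ⨁-cong (λ a → ⨁-cong (λ b → spread (c a b) (j == a) (j == b))) ⟩
  ⨁ (λ a → ⨁ (λ b → ((j == a) ∧ c a b) xor ((j == b) ∧ c a b)))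
    ≡⟨ ⨁-cong (λ a → ⨁-xor (λ b → (j == a) ∧ c a b) (λ b → (j == b) ∧ c a b)) ⟩
  ⨁ (λ a → ⨁ (λ b → (j == a) ∧ c a b) xor ⨁ (λ b → (j == b) ∧ c a b))
    ≡⟨ ⨁-cong (λ a → cong₂ _xor_ (⨁-∧ˡ (j == a) (c a)) (⨁-indicatorˡ j (c a))) ⟩
  ⨁ (λ a → ((j == a) ∧ ⨁ (c a)) xor c a j)
    ≡⟨ ⨁-xor (λ a → (j == a) ∧ ⨁ (c a)) (λ a → c a j) ⟩
  ⨁ (λ a → (j == a) ∧ ⨁ (c a)) xor ⨁ (λ a → c a j)
    ≡⟨ cong (_xor ⨁ (λ a → c a j)) (⨁-indicatorˡ j (λ a → ⨁ (c a))) ⟩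
  ⨁ (c j) xor ⨁ (λ b → c b j)
    ≡⟨ ⨁-xor (c j) (λ b → c b j) ⟨
  ⨁ (λ b → c j b xor c b j) ∎
  where
  open ≡-Reasoning
  spread : ∀ c x y → c ∧ (x xor y) ≡ (x ∧ c) xor (y ∧ c)
  spread = solve-∀ GF₂

module ApexDecomposition {n : ℕ} (D : Graph (suc n)) where

  upper : Fin n → Fin n → Bool
  upper a b = (a ≺ b) ∧ D (suc a) (suc b)

  apexTriangle : Fin n → Fin n → Graph (suc n)
  apexTriangle a b = triangle zero (suc a) (suc b)

  triangleSum : Graph (suc n)
  triangleSum = ⨁ᴳ λ a → ⨁ᴳ λ b → upper a b · apexTriangle a b

  apexTriangle-away : (a b i j : Fin n) → apexTriangle a b (suc i) (suc j) ≡ edge a b i j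
  apexTriangle-away a b i j rewrite ∧-zeroʳ (i == a) | ∧-zeroʳ (i == b) = refl

  apexTriangle-from-apex : (a b j : Fin n) → apexTriangle a b zero (suc j) ≡ (j == a) xor (j == b)
  apexTriangle-from-apex a b j rewrite xor-identityʳ (j == a) | xor-identityʳ (j == b) = cong ((j == a) xor_) (xor-identityʳ (j == b))

  apexTriangle-to-apex : (a b j : Fin n) → apexTriangle a b (suc j) zero ≡ (j == a) xor (j == b)
  apexTriangle-to-apex a b j
    rewrite ∧-identityʳ (j == a) | ∧-identityʳ (j == b) | ∧-zeroʳ (j == a) | ∧-zeroʳ (j == b) =
    cong ((j == a) xor_) (xor-identityʳ (j == b))

  module _ (symmetric : Symmetric D) (loopless : Loopless D) where

    upper-both-ways : (i j : Fin n) → upper i j xor upper j i ≡ D (suc i) (suc j)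
    upper-both-ways i j = trans (cong (λ t → upper i j xor ((j ≺ i) ∧ t)) (symmetric (suc j) (suc i)))
                                (sym (split-by-order (loopless ∘ suc) i j))

    module _ (even : ∀ i → oddDegree D i ≡ false) where

      spokes : (j : Fin n) → ⨁ (λ a → ⨁ (λ b → upper a b ∧ ((j == a) xor (j == b)))) ≡ D zero (suc j)
      spokes j = begin
        ⨁ (λ a → ⨁ (λ b → upper a b ∧ ((j == a) xor (j == b)))) ≡⟨ ⨁²-star upper j ⟩
        ⨁ (λ b → upper j b xor upper b j)                        ≡⟨ ⨁-cong (upper-both-ways j) ⟩
        ⨁ (λ b → D (suc j) (suc b))                              ≡⟨ xor≡false⇒≡ (even (suc j)) ⟨
        D (suc j) zero                                           ≡⟨ symmetric (suc j) zero ⟩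
        D zero (suc j)                                           ∎
        where open ≡-Reasoning

      triangleSum-≐ : triangleSum ≐ D
      triangleSum-≐ zero zero = trans
        (⨁-false (λ a → ⨁ (λ b → upper a b ∧ false))
                 (λ a → ⨁-false (λ b → upper a b ∧ false) (λ b → ∧-zeroʳ (upper a b))))
        (sym (loopless zero))
      triangleSum-≐ (suc i) (suc j) = begin
        ⨁ (λ a → ⨁ (λ b → upper a b ∧ apexTriangle a b (suc i) (suc j)))
          ≡⟨ ⨁-cong (λ a → ⨁-cong (λ b → cong (upper a b ∧_) (apexTriangle-away a b i j))) ⟩
        ⨁ (λ a → ⨁ (λ b → upper a b ∧ edge a b i j))
          ≡⟨ ⨁²-edge upper i j ⟩
        upper i j xor upper j i
          ≡⟨ upper-both-ways i j ⟩
        D (suc i) (suc j) ∎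
        where open ≡-Reasoning
      triangleSum-≐ zero (suc j) =
        trans (⨁-cong (λ a → ⨁-cong (λ b → cong (upper a b ∧_) (apexTriangle-from-apex a b j)))) (spokes j)
      triangleSum-≐ (suc i) zero =
        trans (⨁-cong (λ a → ⨁-cong (λ b → cong (upper a b ∧_) (apexTriangle-to-apex a b i))))
              (trans (spokes i) (symmetric zero (suc i)))

    ⨁²-upper : ⨁ (λ a → ⨁ (upper a)) ≡ oddSize D xor oddDegree D zero
    ⨁²-upper rewrite loopless zero = cancel (⨁ (λ b → D zero (suc b))) (⨁ (λ a → ⨁ (upper a)))
      where
      cancel : ∀ s u → u ≡ (s xor u) xor s
      cancel = solve-∀ GF₂

-- With vertex zero as apex, the triangles on the edges away from the apex sum to D because all degrees
-- are even; there is an even number of them, so each can be paired with one fixed apex triangle.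
evenGraph-isCliqueSum : 2 ≤ p → p + 2 ≤ n → {D : Graph n} → Symmetric D → Loopless D →
                        (∀ i → oddDegree D i ≡ false) → oddSize D ≡ false → IsCliqueSum p D
evenGraph-isCliqueSum 2≤p room = at-least-four-vertices (≤-trans (+-monoˡ-≤ 2 2≤p) room) 2≤p room
  where
  at-least-four-vertices : 4 ≤ n → 2 ≤ p → p + 2 ≤ n → {D : Graph n} → Symmetric D → Loopless D →
                        (∀ i → oddDegree D i ≡ false) → oddSize D ≡ false → IsCliqueSum p D
  at-least-four-vertices {p = p} (s≤s {n = suc (suc m)} (s≤s (s≤s _))) 2≤p room {D} symmetric loopless even even-size =
    isCliqueSum-resp decomposition
      (⨁ᴳ-isCliqueSum λ a → ⨁ᴳ-isCliqueSum λ b → ·-isCliqueSum (upper a b) (paired a b))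
    where
    open ApexDecomposition D
    reference : Graph (suc (suc (suc m)))
    reference = apexTriangle zero (suc zero)
    paired : ∀ a b → upper a b ≡ true → IsCliqueSum p (apexTriangle a b ⊕ reference)
    paired a b ab-edge = triangle-pair 2≤p room {o = zero} {suc a} {suc b} {suc zero} {suc (suc zero)}
                           (λ ()) (λ ()) (λ ()) (λ ()) (≺⇒≢ (∧-conicalˡ (a ≺ b) _ ab-edge) ∘ suc-injective) (λ ())
    decomposition : D ≐ ⨁ᴳ λ a → ⨁ᴳ λ b → upper a b · (apexTriangle a b ⊕ reference)
    decomposition i j = sym (begin
      ⨁ (λ a → ⨁ (λ b → upper a b ∧ (apexTriangle a b i j xor reference i j)))
        ≡⟨ ⨁-cong (λ a → ⨁-∧-xor (upper a) (λ b → apexTriangle a b i j) (reference i j)) ⟩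
      ⨁ (λ a → ⨁ (λ b → upper a b ∧ apexTriangle a b i j) xor (⨁ (upper a) ∧ reference i j))
        ≡⟨ ⨁-xor (λ a → ⨁ (λ b → upper a b ∧ apexTriangle a b i j)) (λ a → ⨁ (upper a) ∧ reference i j) ⟩
      triangleSum i j xor ⨁ (λ a → ⨁ (upper a) ∧ reference i j)
        ≡⟨ cong₂ _xor_ (triangleSum-≐ symmetric loopless even i j) (⨁-∧ʳ (λ a → ⨁ (upper a)) (reference i j)) ⟩
      D i j xor (⨁ (λ a → ⨁ (upper a)) ∧ reference i j)
        ≡⟨ cong (λ c → D i j xor (c ∧ reference i j))
                (trans (⨁²-upper symmetric loopless) (cong₂ _xor_ even-size (even zero))) ⟩
      D i j xor false
        ≡⟨ xor-identityʳ (D i j) ⟩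
      D i j ∎)
      where open ≡-Reasoning

-- Correcting degrees and number of edges

isCliqueSum-symmetric : {G : Graph n} → IsCliqueSum p G → Symmetric G
isCliqueSum-symmetric (Xs , _ , G≐) i j = trans (G≐ i j) (trans (cliqueSum-symmetric Xs i j) (sym (G≐ j i)))

isCliqueSum-loopless : {G : Graph n} → IsCliqueSum p G → Loopless G
isCliqueSum-loopless (Xs , _ , G≐) i = trans (G≐ i i) (cliqueSum-loopless Xs i)

-- D ⊕ H has even degrees and an even number of edges, and D = (D ⊕ H) ⊕ H.
isCliqueSum-by-invariants : 2 ≤ p → p + 2 ≤ n → {D H : Graph n} → Symmetric D → Loopless D → IsCliqueSum p H →
                            (∀ i → oddDegree D i ≡ oddDegree H i) → oddSize D ≡ oddSize H → IsCliqueSum p D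
isCliqueSum-by-invariants {p = p} 2≤p room {D} {H} D-symmetric D-loopless H-sum same-degrees same-size =
  isCliqueSum-resp (λ i j → sym (xor-cancelʳ (D i j) (H i j))) (⊕-isCliqueSum difference-sum H-sum)
  where
  xor-cancelʳ : ∀ x y → (x xor y) xor y ≡ x
  xor-cancelʳ = solve-∀ GF₂
  difference-sum : IsCliqueSum p (D ⊕ H)
  difference-sum = evenGraph-isCliqueSum 2≤p room
    (λ i j → cong₂ _xor_ (D-symmetric i j) (isCliqueSum-symmetric H-sum i j))
    (λ i → cong₂ _xor_ (D-loopless i) (isCliqueSum-loopless H-sum i))
    (λ i → trans (oddDegree-⊕ D H i) (trans (cong (_xor oddDegree H i) (same-degrees i)) (xor-same (oddDegree H i))))
    (trans (oddSize-⊕ D H) (trans (cong (_xor oddSize H) same-size) (xor-same (oddSize H))))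

module _ (2≤p : 2 ≤ p) (room : p + 2 ≤ suc n) where

  private
    ends : Fin n → List (Fin (suc n))
    ends a = zero ∷ suc a ∷ []

    core : Fin n → Fin (suc n) → Bool
    core a = fresh (p ∸ 1) (ends a)

    core+ : Fin n → Fin (suc n) → Subset (suc n)
    core+ a u = fromPred (toggle u (core a))

    ∣core+∣ : (a : Fin n) {u : Fin (suc n)} → u ∈ ends a → ∣ core+ a u ∣ ≡ p
    ∣core+∣ a {u} u∈ends = begin
      ∣ core+ a u ∣               ≡⟨ ∣fromPred∣ (toggle u (core a)) ⟩
      count (toggle u (core a))   ≡⟨ count-toggle u (core a) (fresh-∉ (p ∸ 1) (ends a) u∈ends) ⟩
      suc (count (core a))        ≡⟨ cong suc (count-fresh (p ∸ 1) (ends a) fits) ⟩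
      suc (p ∸ 1)                 ≡⟨ m+[n∸m]≡n (≤-trans (s≤s z≤n) 2≤p) ⟩
      p                           ∎
      where
      open ≡-Reasoning
      fits : p ∸ 1 + 2 ≤ suc n
      fits = ≤-trans (+-monoˡ-≤ 2 (m∸n≤m p 1)) room

  -- The cliques on R ∪ {zero} and R ∪ {suc a}, for a fresh (p − 1)-set R: their degrees cancel on R.
  pairGraph : Fin n → Graph (suc n)
  pairGraph a = clique (core+ a zero) ⊕ clique (core+ a (suc a))

  pairGraph-isCliqueSum : (a : Fin n) → IsCliqueSum p (pairGraph a)
  pairGraph-isCliqueSum a = ⊕-isCliqueSum (clique-isCliqueSum (∣core+∣ a (here refl)))
                                          (clique-isCliqueSum (∣core+∣ a (there (here refl))))

  oddDegree-pairGraph : (a : Fin n) (i : Fin (suc n)) →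
                        oddDegree (pairGraph a) i ≡ not (odd p) ∧ ((i == zero) xor (i == suc a))
  oddDegree-pairGraph a i = begin
    oddDegree (pairGraph a) i
      ≡⟨ oddDegree-⊕ (clique (core+ a zero)) (clique (core+ a (suc a))) i ⟩
    oddDegree (clique (core+ a zero)) i xor oddDegree (clique (core+ a (suc a))) i
      ≡⟨ cong₂ _xor_ (clique-degree zero (here refl)) (clique-degree (suc a) (there (here refl))) ⟩
    ((core a i xor (i == zero)) ∧ not (odd p)) xor ((core a i xor (i == suc a)) ∧ not (odd p))
      ≡⟨ core-cancels (core a i) (i == zero) (i == suc a) (not (odd p)) ⟩
    not (odd p) ∧ ((i == zero) xor (i == suc a)) ∎
    where
    open ≡-Reasoning
    clique-degree : (u : Fin (suc n)) → u ∈ ends a →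
                    oddDegree (clique (core+ a u)) i ≡ (core a i xor (i == u)) ∧ not (odd p)
    clique-degree u u∈ends = trans (oddDegree-clique (core+ a u) i)
      (cong₂ (λ x k → x ∧ not (odd k)) (mem-fromPred (toggle u (core a)) i) (∣core+∣ a u∈ends))
    core-cancels : ∀ r x y e → ((r xor x) ∧ e) xor ((r xor y) ∧ e) ≡ e ∧ (x xor y)
    core-cancels = solve-∀ GF₂

  oddSize-pairGraph : (a : Fin n) → oddSize (pairGraph a) ≡ false
  oddSize-pairGraph a = begin
    oddSize (pairGraph a)          ≡⟨ oddSize-⊕ (clique (core+ a zero)) (clique (core+ a (suc a))) ⟩
    oddSize (clique (core+ a zero)) xor oddSize (clique (core+ a (suc a)))
      ≡⟨ cong₂ _xor_ (trans (oddSize-clique (core+ a zero)) (cong (λ k → odd (k C 2)) (∣core+∣ a (here refl))))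
                     (trans (oddSize-clique (core+ a (suc a))) (cong (λ k → odd (k C 2)) (∣core+∣ a (there (here refl))))) ⟩
    odd (p C 2) xor odd (p C 2)    ≡⟨ xor-same (odd (p C 2)) ⟩
    false                          ∎
    where open ≡-Reasoning

  correction : (Fin (suc n) → Bool) → Graph (suc n)
  correction t = ⨁ᴳ λ a → t (suc a) · pairGraph a

  correction-isCliqueSum : (t : Fin (suc n) → Bool) → IsCliqueSum p (correction t)
  correction-isCliqueSum t = ⨁ᴳ-isCliqueSum λ a → ·-isCliqueSum (t (suc a)) (λ _ → pairGraph-isCliqueSum a)

  oddSize-correction : (t : Fin (suc n) → Bool) → oddSize (correction t) ≡ false
  oddSize-correction t = begin
    oddSize (correction t)                            ≡⟨ oddSize-⨁ᴳ (λ a → t (suc a) · pairGraph a) ⟩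
    ⨁ (λ a → oddSize (t (suc a) · pairGraph a))       ≡⟨ ⨁-cong (λ a → oddSize-· (t (suc a)) (pairGraph a)) ⟩
    ⨁ (λ a → t (suc a) ∧ oddSize (pairGraph a))
      ≡⟨ ⨁-false _ (λ a → trans (cong (t (suc a) ∧_) (oddSize-pairGraph a)) (∧-zeroʳ _)) ⟩
    false                                             ∎
    where open ≡-Reasoning

  oddDegree-correction : (t : Fin (suc n) → Bool) → ⨁ t ≡ false →
                         ∀ i → oddDegree (correction t) i ≡ not (odd p) ∧ t i
  oddDegree-correction t balanced i = begin
    oddDegree (correction t) i
      ≡⟨ oddDegree-⨁ᴳ (λ a → t (suc a) · pairGraph a) i ⟩
    ⨁ (λ a → oddDegree (t (suc a) · pairGraph a) i)
      ≡⟨ ⨁-cong (λ a → trans (oddDegree-· (t (suc a)) (pairGraph a) i) (cong (t (suc a) ∧_) (oddDegree-pairGraph a i))) ⟩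
    ⨁ (λ a → t (suc a) ∧ (not (odd p) ∧ ((i == zero) xor (i == suc a))))
      ≡⟨ collect i ⟩
    not (odd p) ∧ t i ∎
    where
    open ≡-Reasoning
    collect : ∀ i → ⨁ (λ a → t (suc a) ∧ (not (odd p) ∧ ((i == zero) xor (i == suc a)))) ≡ not (odd p) ∧ t i
    collect zero = begin
      ⨁ (λ a → t (suc a) ∧ (not (odd p) ∧ true))
        ≡⟨ ⨁-cong (λ a → cong (t (suc a) ∧_) (∧-identityʳ (not (odd p)))) ⟩
      ⨁ (λ a → t (suc a) ∧ not (odd p))           ≡⟨ ⨁-∧ʳ (t ∘ suc) (not (odd p)) ⟩
      ⨁ (t ∘ suc) ∧ not (odd p)                   ≡⟨ cong (_∧ not (odd p)) (xor≡false⇒≡ balanced) ⟨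
      t zero ∧ not (odd p)                        ≡⟨ ∧-comm (t zero) (not (odd p)) ⟩
      not (odd p) ∧ t zero                        ∎
    collect (suc j) = begin
      ⨁ (λ a → t (suc a) ∧ (not (odd p) ∧ (j == a)))   ≡⟨ ⨁-cong (λ a → rearrange (t (suc a)) (not (odd p)) (j == a)) ⟩
      ⨁ (λ a → (j == a) ∧ (not (odd p) ∧ t (suc a)))   ≡⟨ ⨁-indicatorˡ j (λ a → not (odd p) ∧ t (suc a)) ⟩
      not (odd p) ∧ t (suc j)                          ∎
      where
      rearrange : ∀ x e y → x ∧ (e ∧ y) ≡ y ∧ (e ∧ x)
      rearrange = solve-∀ GF₂

  module _ {D : Graph (suc n)} (D-symmetric : Symmetric D) (D-loopless : Loopless D)
           (even-degrees : odd p ≡ true → ∀ i → oddDegree D i ≡ false)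
           (even-size : odd (p C 2) ≡ false → oddSize D ≡ false) where

    private
      X : Subset (suc n)
      X = fromPred (fresh p [])

      ∣X∣ : ∣ X ∣ ≡ p
      ∣X∣ = trans (∣fromPred∣ {suc n} (fresh p []))
                  (count-fresh {suc n} p [] (≤-trans (≤-reflexive (+-identityʳ p)) (≤-trans (m≤m+n p 2) room)))

      -- one p-clique, if needed to fix the parity of the number of edges
      H₁ : Graph (suc n)
      H₁ = oddSize D · clique X

      H₁-sum : IsCliqueSum p H₁
      H₁-sum = ·-isCliqueSum (oddSize D) (λ _ → clique-isCliqueSum ∣X∣)

      t : Fin (suc n) → Bool
      t i = oddDegree D i xor oddDegree H₁ i

      balanced : ⨁ t ≡ false
      balanced = trans (⨁-xor (oddDegree D) (oddDegree H₁))
        (cong₂ _xor_ (handshake D-symmetric D-loopless)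
                     (handshake (isCliqueSum-symmetric H₁-sum) (isCliqueSum-loopless H₁-sum)))

      H : Graph (suc n)
      H = H₁ ⊕ correction t

      same-degrees : ∀ i → oddDegree D i ≡ oddDegree H i
      same-degrees i = begin
        oddDegree D i
          ≡⟨ fix (odd p) (λ p-odd → even-degrees p-odd i) H₁-even ⟩
        oddDegree H₁ i xor (not (odd p) ∧ t i)
          ≡⟨ cong (oddDegree H₁ i xor_) (oddDegree-correction t balanced i) ⟨
        oddDegree H₁ i xor oddDegree (correction t) i                  ≡⟨ oddDegree-⊕ H₁ (correction t) i ⟨
        oddDegree H i                                                  ∎
        where
        open ≡-Reasoning
        xor-cancelˡ : ∀ d h → d ≡ h xor (d xor h)
        xor-cancelˡ = solve-∀ GF₂
        fix : ∀ o {d h} → (o ≡ true → d ≡ false) → (o ≡ true → h ≡ false) → d ≡ h xor (not o ∧ (d xor h))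
        fix false {d} {h} _ _ = xor-cancelˡ d h
        fix true  d≡false h≡false rewrite d≡false refl | h≡false refl = refl
        H₁-even : odd p ≡ true → oddDegree H₁ i ≡ false
        H₁-even p-odd = begin
          oddDegree H₁ i                                   ≡⟨ oddDegree-· (oddSize D) (clique X) i ⟩
          oddSize D ∧ oddDegree (clique X) i               ≡⟨ cong (oddSize D ∧_) (oddDegree-clique X i) ⟩
          oddSize D ∧ (mem i X ∧ not (odd ∣ X ∣))
            ≡⟨ cong (λ o → oddSize D ∧ (mem i X ∧ not o)) (trans (cong odd ∣X∣) p-odd) ⟩
          oddSize D ∧ (mem i X ∧ false)                    ≡⟨ cong (oddSize D ∧_) (∧-zeroʳ (mem i X)) ⟩
          oddSize D ∧ false                                ≡⟨ ∧-zeroʳ (oddSize D) ⟩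
          false                                            ∎

      same-size : oddSize D ≡ oddSize H
      same-size = begin
        oddSize D                                      ≡⟨ fix (odd (p C 2)) even-size ⟩
        oddSize D ∧ odd (p C 2)                        ≡⟨ cong (λ k → oddSize D ∧ odd (k C 2)) ∣X∣ ⟨
        oddSize D ∧ odd (∣ X ∣ C 2)                    ≡⟨ cong (oddSize D ∧_) (oddSize-clique X) ⟨
        oddSize D ∧ oddSize (clique X)                 ≡⟨ oddSize-· (oddSize D) (clique X) ⟨
        oddSize H₁                                     ≡⟨ xor-identityʳ (oddSize H₁) ⟨
        oddSize H₁ xor false                           ≡⟨ cong (oddSize H₁ xor_) (oddSize-correction t) ⟨
        oddSize H₁ xor oddSize (correction t)          ≡⟨ oddSize-⊕ H₁ (correction t) ⟨
        oddSize H                                      ∎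
        where
        open ≡-Reasoning
        fix : ∀ c {s} → (c ≡ false → s ≡ false) → s ≡ s ∧ c
        fix true  {s} _ = sym (∧-identityʳ s)
        fix false s≡false = trans (s≡false refl) (sym (∧-zeroʳ _))

    parityConditions⇒isCliqueSum : IsCliqueSum p D
    parityConditions⇒isCliqueSum = isCliqueSum-by-invariants 2≤p room D-symmetric D-loopless
      (⊕-isCliqueSum H₁-sum (correction-isCliqueSum t)) same-degrees same-size

ParityConditions : ℕ → Graph n → Set
ParityConditions p G = (odd p ≡ true → ∀ i → oddDegree G i ≡ false) × (odd (p C 2) ≡ false → oddSize G ≡ false)

isCliqueSum⇔parityConditions : 2 ≤ p → p + 2 ≤ n → {D : Graph n} → Symmetric D → Loopless D →
                               IsCliqueSum p D ⇔ ParityConditions p D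
isCliqueSum⇔parityConditions {p} {n} 2≤p room D-symmetric D-loopless = mk⇔
  (λ D-sum → (λ p-odd → isCliqueSum-evenDegrees p-odd D-sum) , (λ pC2-even → isCliqueSum-evenSize pC2-even D-sum))
  (sufficient n room D-symmetric D-loopless)
  where
  sufficient : ∀ n → p + 2 ≤ n → {D : Graph n} → Symmetric D → Loopless D →
               ParityConditions p D → IsCliqueSum p D
  sufficient zero    room with () ← ≤-trans (m≤n+m 2 p) room
  sufficient (suc n) room D-symmetric D-loopless (even-degrees , even-size) =
    parityConditions⇒isCliqueSum 2≤p room D-symmetric D-loopless even-degrees even-size

-- Tournaments

Antisymmetric : Graph n → Set
Antisymmetric a = ∀ i j → i ≢ j → a i j ≡ not (a j i)

invAdj-antisymmetric : {a : Graph n} → Antisymmetric a → (X : Subset n) → Antisymmetric (invAdj a X)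
invAdj-antisymmetric antisym X i j i≢j with mem i X | mem j X
... | true  | true  = antisym j i (≢-sym i≢j)
... | true  | false = antisym i j i≢j
... | false | true  = antisym i j i≢j
... | false | false = antisym i j i≢j

invAdj-offDiagonal : {a : Graph n} → Antisymmetric a → (X : Subset n) → ∀ {i j} → i ≢ j →
                     invAdj a X i j ≡ a i j xor clique X i j
invAdj-offDiagonal {a = a} antisym X {i} {j} i≢j rewrite ==-≢ i≢j with mem i X | mem j X
... | true  | true  = trans (antisym j i (≢-sym i≢j)) (xor-comm true (a i j))
... | true  | false = sym (xor-identityʳ (a i j))
... | false | true  = sym (xor-identityʳ (a i j))
... | false | false = sym (xor-identityʳ (a i j))

invAll-offDiagonal : {a : Graph n} → Antisymmetric a → (Xs : List (Subset n)) → ∀ {i j} → i ≢ j →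
                     invAll a Xs i j ≡ a i j xor cliqueSum Xs i j
invAll-offDiagonal {a = a} antisym []       {i} {j} i≢j = sym (xor-identityʳ (a i j))
invAll-offDiagonal {a = a} antisym (X ∷ Xs) {i} {j} i≢j = begin
  invAll (invAdj a X) Xs i j                              ≡⟨ invAll-offDiagonal (invAdj-antisymmetric antisym X) Xs i≢j ⟩
  invAdj a X i j xor cliqueSum Xs i j
    ≡⟨ cong (_xor cliqueSum Xs i j) (invAdj-offDiagonal antisym X i≢j) ⟩
  (a i j xor clique X i j) xor cliqueSum Xs i j           ≡⟨ xor-assoc (a i j) (clique X i j) (cliqueSum Xs i j) ⟩
  a i j xor cliqueSum (X ∷ Xs) i j                        ∎
  where open ≡-Reasoning

invAll-diagonal : (a : Graph n) (Xs : List (Subset n)) (i : Fin n) → invAll a Xs i i ≡ a i i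
invAll-diagonal a []       i = refl
invAll-diagonal a (X ∷ Xs) i = trans (invAll-diagonal (invAdj a X) Xs i) (if-eta (mem i X ∧ mem i X))

module _ (T₁ T₂ : Tournament n) where

  ReachableByInversions : ℕ → Set
  ReachableByInversions p =
    Σ (List (Subset n)) λ Xs → All (λ X → ∣ X ∣ ≡ p) Xs × (∀ i j → adj T₂ i j ≡ invAll (adj T₁) Xs i j)

  difference : Graph n
  difference = adj T₁ ⊕ adj T₂

  difference-symmetric : Symmetric difference
  difference-symmetric i j with i ≟ j
  ... | yes refl = refl
  ... | no  i≢j  = trans (cong₂ _xor_ (tourn T₁ i j i≢j) (tourn T₂ i j i≢j))
                         (xor-annihilates-not (adj T₁ j i) (adj T₂ j i))

  difference-loopless : Loopless difference
  difference-loopless i = cong₂ _xor_ (irrefl T₁ i) (irrefl T₂ i)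

  inversion⇔isCliqueSum : ReachableByInversions p ⇔ IsCliqueSum p difference
  inversion⇔isCliqueSum = mk⇔ to from
    where
    cancel : ∀ x y → y ≡ x xor (x xor y)
    cancel = solve-∀ GF₂
    to : ReachableByInversions p → IsCliqueSum p difference
    to (Xs , sizes , T₂≡) = isCliqueSum-offDiagonal difference-loopless agrees (Xs , sizes , λ _ _ → refl)
      where
      agrees : ∀ i j → i ≢ j → difference i j ≡ cliqueSum Xs i j
      agrees i j i≢j = trans (cong (adj T₁ i j xor_) (trans (T₂≡ i j) (invAll-offDiagonal (tourn T₁) Xs i≢j)))
                             (sym (cancel (adj T₁ i j) (cliqueSum Xs i j)))
    from : IsCliqueSum p difference → ReachableByInversions p
    from (Xs , sizes , D≐) = Xs , sizes , T₂≡
      where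
      T₂≡ : ∀ i j → adj T₂ i j ≡ invAll (adj T₁) Xs i j
      T₂≡ i j with i ≟ j
      ... | yes refl = trans (irrefl T₂ i) (sym (trans (invAll-diagonal (adj T₁) Xs i) (irrefl T₁ i)))
      ... | no  i≢j  = trans (cancel (adj T₁ i j) (adj T₂ i j))
                             (sym (trans (invAll-offDiagonal (tourn T₁) Xs i≢j) (cong (adj T₁ i j xor_) (sym (D≐ i j)))))

  private
    odd-sum-allFin : (f : Fin n → ℕ) → odd (sum (map f (allFin n))) ≡ ⨁ (odd ∘ f)
    odd-sum-allFin f = trans (cong (odd ∘ sum) (map-tabulate id f)) (odd-sum f)

    odd-numF : (T : Tournament n) → odd (numF T) ≡ oddSize (adj T)
    odd-numF T = trans (odd-sum-allFin _) (⨁-cong λ i → trans (odd-sum-allFin _) (⨁-cong λ j → odd-b2n (fwd T i j)))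

    odd-numFv : (T : Tournament n) (i : Fin n) → odd (numFv T i) ≡ ⨁ (λ j → fwd T i j xor fwd T j i)
    odd-numFv T i = trans (odd-sum-allFin _)
      (⨁-cong λ j → trans (odd-+ (b2n (fwd T i j)) _) (cong₂ _xor_ (odd-b2n (fwd T i j)) (odd-b2n (fwd T j i))))

    oddDegree-difference : (i : Fin n) → oddDegree difference i ≡ odd (numFv T₁ i) xor odd (numFv T₂ i)
    oddDegree-difference i = begin
      ⨁ (difference i)
        ≡⟨ ⨁-cong (λ j → trans (split-by-order difference-loopless i j)
                                (cong (λ d → ((i ≺ j) ∧ difference i j) xor ((j ≺ i) ∧ d)) (difference-symmetric i j))) ⟩
      ⨁ (λ j → ((i ≺ j) ∧ difference i j) xor ((j ≺ i) ∧ difference j i))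
        ≡⟨ ⨁-cong (λ j → regroup (i ≺ j) (j ≺ i) (adj T₁ i j) (adj T₁ j i) (adj T₂ i j) (adj T₂ j i)) ⟩
      ⨁ (λ j → (fwd T₁ i j xor fwd T₁ j i) xor (fwd T₂ i j xor fwd T₂ j i))
        ≡⟨ ⨁-xor (λ j → fwd T₁ i j xor fwd T₁ j i) (λ j → fwd T₂ i j xor fwd T₂ j i) ⟩
      ⨁ (λ j → fwd T₁ i j xor fwd T₁ j i) xor ⨁ (λ j → fwd T₂ i j xor fwd T₂ j i)
        ≡⟨ cong₂ _xor_ (odd-numFv T₁ i) (odd-numFv T₂ i) ⟨
      odd (numFv T₁ i) xor odd (numFv T₂ i) ∎
      where
      open ≡-Reasoning
      regroup : ∀ l r a₁ b₁ a₂ b₂ →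
                (l ∧ (a₁ xor a₂)) xor (r ∧ (b₁ xor b₂)) ≡ ((l ∧ a₁) xor (r ∧ b₁)) xor ((l ∧ a₂) xor (r ∧ b₂))
      regroup = solve-∀ GF₂

  parityConditions⇔ : ParityConditions p difference ⇔
                      ((odd p ≡ true → ∀ (i : Fin n) → suc (toℕ i) < n → numFv T₁ i % 2 ≡ numFv T₂ i % 2)
                       × (odd (p C 2) ≡ false → numF T₁ % 2 ≡ numF T₂ % 2))
  parityConditions⇔ = mk⇔
    (λ (degrees , size) → (λ p-odd i _ → Equivalence.from (vertex⇔ i) (degrees p-odd i))
                        , (λ pC2-even → Equivalence.from arcs⇔ (size pC2-even)))
    (λ (vertices , arcs) → (λ p-odd → ⨁-except-last (oddDegree difference)
                                          (handshake difference-symmetric difference-loopless)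
                                          (λ i i<n → Equivalence.to (vertex⇔ i) (vertices p-odd i i<n)))
                         , (λ pC2-even → Equivalence.to arcs⇔ (arcs pC2-even)))
    where
    vertex⇔ : ∀ i → (numFv T₁ i % 2 ≡ numFv T₂ i % 2) ⇔ (oddDegree difference i ≡ false)
    vertex⇔ i = same-parity⇔ {numFv T₁ i} {numFv T₂ i} refl refl (oddDegree-difference i)
    arcs⇔ : (numF T₁ % 2 ≡ numF T₂ % 2) ⇔ (oddSize difference ≡ false)
    arcs⇔ = same-parity⇔ {numF T₁} {numF T₂} (odd-numF T₁) (odd-numF T₂) (oddSize-⊕ (adj T₁) (adj T₂))

mod4-cases : ∀ p {A B : Set} →
             ((odd p ≡ true → A) × (odd (p C 2) ≡ false → B)) ⇔
             ((p % 4 ≡ 0 × B) ⊎ (p % 4 ≡ 1 × A × B) ⊎ p % 4 ≡ 2 ⊎ (p % 4 ≡ 3 × A))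
mod4-cases p {A} {B} = mk⇔ to from
  where
  to : (odd p ≡ true → A) × (odd (p C 2) ≡ false → B) →
       (p % 4 ≡ 0 × B) ⊎ (p % 4 ≡ 1 × A × B) ⊎ p % 4 ≡ 2 ⊎ (p % 4 ≡ 3 × A)
  to (a , b) with p % 4 | odd-mod4 p | odd-C2-mod4 p | m%n<n p 4
  ... | 0 | _        | p-C2-odd | _ = inj₁ (refl , b (sym p-C2-odd))
  ... | 1 | p-odd    | p-C2-odd | _ = inj₂ (inj₁ (refl , a (sym p-odd) , b (sym p-C2-odd)))
  ... | 2 | _        | _        | _ = inj₂ (inj₂ (inj₁ refl))
  ... | 3 | p-odd    | _        | _ = inj₂ (inj₂ (inj₂ (refl , a (sym p-odd))))
  ... | suc (suc (suc (suc _))) | _ | _ | s≤s (s≤s (s≤s (s≤s ())))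

  odd-residue : ∀ {r} → p % 4 ≡ r → odd p ≡ odd r
  odd-residue p%4≡r = trans (sym (odd-mod4 p)) (cong odd p%4≡r)

  odd-C2-residue : ∀ {r} → p % 4 ≡ r → odd (p C 2) ≡ odd (r C 2)
  odd-C2-residue p%4≡r = trans (sym (odd-C2-mod4 p)) (cong (λ r → odd (r C 2)) p%4≡r)

  from : (p % 4 ≡ 0 × B) ⊎ (p % 4 ≡ 1 × A × B) ⊎ p % 4 ≡ 2 ⊎ (p % 4 ≡ 3 × A) →
         (odd p ≡ true → A) × (odd (p C 2) ≡ false → B)
  from (inj₁ (p%4≡0 , b))                 = (λ p-odd → case (trans (sym (odd-residue p%4≡0)) p-odd) of λ ()) , (λ _ → b)
  from (inj₂ (inj₁ (_ , a , b)))          = (λ _ → a) , (λ _ → b)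
  from (inj₂ (inj₂ (inj₁ p%4≡2)))         = (λ p-odd → case (trans (sym (odd-residue p%4≡2)) p-odd) of λ ())
                                          , (λ pC2-even → case (trans (sym (odd-C2-residue p%4≡2)) pC2-even) of λ ())
  from (inj₂ (inj₂ (inj₂ (p%4≡3 , a)))) = (λ _ → a)
                                          , (λ pC2-even → case (trans (sym (odd-C2-residue p%4≡3)) pC2-even) of λ ())

theorem1p1 : (n p : ℕ) → 2 ≤ p → p + 2 ≤ n → (T₁ T₂ : Tournament n) →
    (Σ (List (Subset n)) (λ Xs → All (λ X → ∣ X ∣ ≡ p) Xs
        × (∀ i j → adj T₂ i j ≡ invAll (adj T₁) Xs i j)))
    ⇔
    ((p % 4 ≡ 0 × numF T₁ % 2 ≡ numF T₂ % 2)
     ⊎ (p % 4 ≡ 1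
        × (∀ (i : Fin n) → suc (toℕ i) < n → numFv T₁ i % 2 ≡ numFv T₂ i % 2)
        × numF T₁ % 2 ≡ numF T₂ % 2)
     ⊎ p % 4 ≡ 2
     ⊎ (p % 4 ≡ 3
        × (∀ (i : Fin n) → suc (toℕ i) < n → numFv T₁ i % 2 ≡ numFv T₂ i % 2)))
theorem1p1 n p 2≤p room T₁ T₂ =
  ⇔-trans (inversion⇔isCliqueSum T₁ T₂)
  (⇔-trans (isCliqueSum⇔parityConditions 2≤p room (difference-symmetric T₁ T₂) (difference-loopless T₁ T₂))
  (⇔-trans (parityConditions⇔ T₁ T₂ {p = p})
           (mod4-cases p)))
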